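{- Let $G$ be a finite abelian CI-group having a Sylow subgroup isomorphic to $\mathbb{Z}_4$, $\mathbb{Z}_8$ or $\mathbb{Z}_9$. Then $G$ does not have the $k$-if property for any integer $k\geq2$.
   Context: For a finite group $G$ let $G^*=G\setminus\{1\}$. For an inverse-closed $S\subseteq G^*$, $\mathrm{Cay}(G,S)$ has vertex set $G$ and edges $\{h,g\}$ with $gh^{ -1}\in S$. $G$ is a CI-group if for all inverse-closed $S,T\subseteq G^*$, $\mathrm{Cay}(G,S)\cong\mathrm{Cay}(G,T)$ implies $T=S^{\alpha}$ for some $\alpha\in\mathrm{Aut}(G)$. A partition of a set is a collection of non-empty pairwise disjoint subsets whose union is the set. $\mathrm{Cay}(G,S)$ is a $k$-if Cayley graph if there is a partition $\{S_0=S,\dots,S_{k-1}\}$ of $G^*$ into inverse-closed subsets with $\mathrm{Cay}(G,S_i)\cong\mathrm{Cay}(G,S)$ for all $i$; $G$ has the $k$-if property if some $\mathrm{Cay}(G,S)$ is a $k$-if Cayley graph. -}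

module Defs where

open import Data.Nat using (ℕ; zero; suc; _+_; _*_; _^_; _≥_)
open import Data.Nat.DivMod using (_mod_)
open import Data.Nat.Divisibility using (_∣_)
open import Data.Nat.Primality using (Prime)
open import Data.Fin using (Fin; toℕ)
open import Data.Fin.Subset using (Subset; _∈_; _∉_)
open import Data.Fin.Permutation using (Permutation; _⟨$⟩ʳ_)
open import Data.Product using (Σ; ∃; ∃-syntax; _×_; _,_)
open import Data.Sum using (_⊎_)
open import Function.Bundles using (_⇔_)
open import Function.Definitions using (Injective)
open import Relation.Binary.PropositionalEquality using (_≡_)
open import Relation.Nullary using (¬_)
open import Algebra.Structures using (IsGroup)

-- A finite group of order n, carried (up to isomorphism) by Fin n.
record FinGroup (n : ℕ) : Set where
  field
    _·_     : Fin n → Fin n → Fin n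
    e       : Fin n
    inv     : Fin n → Fin n
    isGroup : IsGroup _≡_ _·_ e inv
  infixl 7 _·_

module _ {n : ℕ} (G : FinGroup n) where
  open FinGroup G

  IsAbelian : Set
  IsAbelian = ∀ a b → a · b ≡ b · a

  IsConnSet : Subset n → Set
  IsConnSet S = (e ∉ S) × (∀ g → g ∈ S → inv g ∈ S)

  -- Cay(G,S) ≅ Cay(G,T): a bijection of vertex sets preserving adjacency
  -- {h,g} edge of Cay(G,S) iff g h⁻¹ ∈ S.
  CayIso : Subset n → Subset n → Set
  CayIso S T = Σ (Permutation n n) λ f →
    ∀ g h → ((g · inv h) ∈ S) ⇔ (((f ⟨$⟩ʳ g) · inv (f ⟨$⟩ʳ h)) ∈ T)

  IsAut : Permutation n n → Set
  IsAut α = ∀ a b → α ⟨$⟩ʳ (a · b) ≡ (α ⟨$⟩ʳ a) · (α ⟨$⟩ʳ b)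

  IsImage : Permutation n n → Subset n → Subset n → Set
  IsImage α S T = ∀ g → (g ∈ S) ⇔ ((α ⟨$⟩ʳ g) ∈ T)

  IsCI : Set
  IsCI = ∀ S T → IsConnSet S → IsConnSet T → CayIso S T →
         Σ (Permutation n n) λ α → IsAut α × IsImage α S T

  IsInvClosedPartition : (k : ℕ) → (Fin k → Subset n) → Set
  IsInvClosedPartition k P =
      (∀ i → IsConnSet (P i))
    × (∀ i → ∃[ g ] g ∈ P i)
    × (∀ i j g → g ∈ P i → g ∈ P j → i ≡ j)
    × (∀ g → ¬ (g ≡ e) → ∃[ i ] g ∈ P i)

  IsKIfCayley : ℕ → Subset n → Set
  IsKIfCayley k S = Σ (Fin k → Subset n) λ P →
      IsInvClosedPartition k P
    × (∃[ i ] P i ≡ S)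
    × (∀ i → CayIso (P i) S)

  HasKIf : ℕ → Set
  HasKIf k = ∃[ S ] IsKIfCayley k S

  -- Z_m (m = suc m') embedded in G as a subgroup H = image of φ,
  -- and H is a Sylow p-subgroup: |H| = m = p^a, p prime, p^(a+1) ∤ |G|.
  addMod : (m : ℕ) → Fin (suc m) → Fin (suc m) → Fin (suc m)
  addMod m a b = (toℕ a + toℕ b) mod (suc m)

  HasSylowIsoCyclic : ℕ → Set
  HasSylowIsoCyclic m' = Σ (Fin (suc m') → Fin n) λ φ →
      Injective _≡_ _≡_ φ
    × (∀ a b → φ (addMod m' a b) ≡ φ a · φ b)
    × (∃[ p ] ∃[ a ] Prime p × (suc m' ≡ p ^ a) × ¬ (p * suc m' ∣ n))

{-# OPTIONS --safe #-}
module Submission where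

-- Let C be the Sylow p-subgroup (cyclic of order 4, 8 or 9) and z ∈ C an element of order p,
-- chosen so that e, z and z⁻¹ are the only solutions of a ^ p ≡ e in C.  In an abelian group
-- every w with w ^ p ≡ e lies in C: otherwise C⟨w⟩ is a subgroup of order p·|C|, which
-- Lagrange's theorem forbids.  As automorphisms preserve w ^ p ≡ e, each one maps z to z or z⁻¹.
-- In a k-if partition {P i} of G* with Cay(G, P i) ≅ Cay(G, S), the CI property makes each P i
-- an automorphic image of the inverse-closed set S, so z ∈ P i ⇔ z ∈ S for every i.  As z lies
-- in some part it lies in all of them, which is impossible for k ≥ 2 disjoint parts.

open import Defs
open import Algebra.Bundles using (Group; AbelianGroup)
open import Algebra.Structures using (IsGroup)
open import Data.Empty using (⊥-elim)
open import Data.Fin as Fin using (Fin; zero; suc; toℕ; punchIn; remQuot; combine)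
open import Data.Fin.Patterns using (2F; 3F; 4F)
open import Data.Fin.Permutation using (Permutation; _⟨$⟩ʳ_)
open import Data.Fin.Properties as Finₚ
  using (punchInᵢ≢i; any?; toℕ-fromℕ<; remQuot-combine; combine-remQuot)
  renaming (_≟_ to _≟ᶠ_)
open import Data.Fin.Subset using (_∈_)
open import Data.Nat as ℕ
  using (ℕ; zero; suc; _+_; _*_; _∸_; _/_; _%_; _≤_; _<_; _≥_; s≤s; NonZero; >-nonZero)
open import Data.Nat.Coprimality using (coprime-Bézout; prime⇒coprime)
open import Data.Nat.DivMod
  using (_mod_; m≡m%n+[m/n]*n; m%n<n; %-distribˡ-+; m%n%n≡m%n; n%n≡0)
open import Data.Nat.Divisibility using (_∣_; divides; ∣1⇒≡1)
open import Data.Nat.GCD using (module Bézout)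
open import Data.Nat.Primality
  using (Prime; prime?; prime[2]; ¬prime[1]; prime⇒nonZero; prime⇒irreducible; euclidsLemma)
import Data.Nat.Properties as ℕₚ
open import Data.Product using (∃; ∃-syntax; _×_; _,_; proj₁; proj₂; uncurry)
open import Data.Sum using (_⊎_; inj₁; inj₂)
open import Function using (_∘_)
open import Function.Bundles using (Injection; Equivalence; _⇔_; mk⇔)
open import Function.Definitions using (Injective)
import Function.Properties.Equivalence as ⇔
open import Function.Properties.Inverse using (↔⇒↣)
open import Level using (0ℓ)
open import Relation.Binary using (tri<; tri≈; tri>)
open import Relation.Binary.PropositionalEquality
open import Relation.Nullary using (¬_; Dec; yes; no)
open import Relation.Nullary.Decidable using (_→-dec_; _⊎-dec_; from-yes)

open import Algebra.Properties.Semiring.Sum ℕₚ.+-*-semiring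
  using (sum; sum-syntax; sum-remove; sum-cong-≗; sum-replicate-zero; ∑-comm; *-distribˡ-sum)

module _ {n : ℕ} where
  open import Algebra.Construct.NaturalChoice.Min (Finₚ.≤-totalOrder n)
    using (_⊓_; x⊓y≤x; x⊓y≤y; ⊓-sel)

  least : ∀ {m} → (Fin (suc m) → Fin n) → Fin n
  least {zero}  f = f zero
  least {suc m} f = f zero ⊓ least (f ∘ suc)

  least-≤ : ∀ {m} (f : Fin (suc m) → Fin n) i → least f Fin.≤ f i
  least-≤ {zero}  f zero    = Finₚ.≤-refl {x = f zero}
  least-≤ {suc m} f zero    = x⊓y≤x _ _
  least-≤ {suc m} f (suc i) = Finₚ.≤-trans (x⊓y≤y (f zero) _) (least-≤ (f ∘ suc) i)

  least-attained : ∀ {m} (f : Fin (suc m) → Fin n) → ∃[ i ] least f ≡ f i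
  least-attained {zero}  f = zero , refl
  least-attained {suc m} f with ⊓-sel (f zero) (least (f ∘ suc))
  ... | inj₁ eq = zero , eq
  ... | inj₂ eq = let i , eq′ = least-attained (f ∘ suc) in suc i , trans eq eq′

  least-mono : ∀ {m} (f g : Fin (suc m) → Fin n) →
               (∀ j → ∃[ i ] g j ≡ f i) → least f Fin.≤ least g
  least-mono f g g⊆f with least-attained g
  ... | j , eq with g⊆f j
  ... | i , eq′ = subst (least f Fin.≤_) (sym (trans eq eq′)) (least-≤ f i)

  least-cong : ∀ {m} (f g : Fin (suc m) → Fin n) →
               (∀ i → ∃[ j ] f i ≡ g j) → (∀ j → ∃[ i ] g j ≡ f i) → least f ≡ least g
  least-cong f g f⊆g g⊆f = Finₚ.≤-antisym (least-mono f g g⊆f) (least-mono g f f⊆g)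

𝟙[_] : {P : Set} → Dec P → ℕ
𝟙[ yes _ ] = 1
𝟙[ no _ ]  = 0

𝟙-yes : {P : Set} (d : Dec P) → P → 𝟙[ d ] ≡ 1
𝟙-yes (yes _) _ = refl
𝟙-yes (no ¬p) p = ⊥-elim (¬p p)

𝟙-no : {P : Set} (d : Dec P) → ¬ P → 𝟙[ d ] ≡ 0
𝟙-no (yes p) ¬p = ⊥-elim (¬p p)
𝟙-no (no _)  _  = refl

∑-const : ∀ m c → ∑[ i < m ] c ≡ m * c
∑-const zero    c = refl
∑-const (suc m) c = cong (c +_) (∑-const m c)

∑-zero : ∀ {m} (f : Fin m → ℕ) → (∀ i → f i ≡ 0) → ∑[ i < m ] f i ≡ 0
∑-zero {m} f vanishes = trans (sum-cong-≗ vanishes) (sum-replicate-zero m)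

∑-single : ∀ {m} (f : Fin m → ℕ) c → (∀ i → i ≢ c → f i ≡ 0) → ∑[ i < m ] f i ≡ f c
∑-single {suc m} f c vanishes = begin
  sum f                             ≡⟨ sum-remove {i = c} f ⟩
  f c + ∑[ j < m ] f (punchIn c j)  ≡⟨ cong (f c +_) (∑-zero _ (λ j → vanishes _ (punchInᵢ≢i c j))) ⟩
  f c + 0                           ≡⟨ ℕₚ.+-identityʳ (f c) ⟩
  f c                               ∎
  where open ≡-Reasoning

∑-𝟙≡ : ∀ {m} (c : Fin m) → ∑[ i < m ] 𝟙[ c ≟ᶠ i ] ≡ 1
∑-𝟙≡ c = trans (∑-single (λ i → 𝟙[ c ≟ᶠ i ]) c (λ i i≢c → 𝟙-no (c ≟ᶠ i) (i≢c ∘ sym)))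
               (𝟙-yes (c ≟ᶠ c) refl)

prime-∣-prime-power : ∀ {p q} a → Prime p → Prime q → p ∣ q ℕ.^ a → p ≡ q
prime-∣-prime-power zero p-prime _ p∣1 = ⊥-elim (¬prime[1] (subst Prime (∣1⇒≡1 p∣1) p-prime))
prime-∣-prime-power {p} {q} (suc a) p-prime q-prime p∣q^[1+a]
  with euclidsLemma q (q ℕ.^ a) p-prime p∣q^[1+a]
... | inj₂ p∣q^a = prime-∣-prime-power a p-prime q-prime p∣q^a
... | inj₁ p∣q with prime⇒irreducible q-prime p∣q
...   | inj₁ p≡1 = ⊥-elim (¬prime[1] (subst Prime p≡1 p-prime))
...   | inj₂ p≡q = p≡q

-- ℤ/(m+1) on Fin (suc m); _⊕_ unfolds to Defs.addMod, which ignores its group argument.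
module _ {m : ℕ} where
  infixl 6 _⊕_
  infixr 7 _⊛_

  _⊕_ : Fin (suc m) → Fin (suc m) → Fin (suc m)
  a ⊕ b = (toℕ a + toℕ b) mod suc m

  ⊖_ : Fin (suc m) → Fin (suc m)
  ⊖ a = (suc m ∸ toℕ a) mod suc m

  _⊛_ : ℕ → Fin (suc m) → Fin (suc m)
  zero  ⊛ a = zero
  suc k ⊛ a = a ⊕ k ⊛ a

  ⊕-inverseʳ : ∀ a → a ⊕ ⊖ a ≡ zero
  ⊕-inverseʳ a = Finₚ.toℕ-injective (begin
    toℕ (a ⊕ ⊖ a)                ≡⟨ toℕ-fromℕ< (m%n<n (i + toℕ (⊖ a)) M) ⟩
    (i + toℕ (⊖ a)) % M          ≡⟨ cong (λ t → (i + t) % M) (toℕ-fromℕ< (m%n<n (M ∸ i) M)) ⟩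
    (i + (M ∸ i) % M) % M        ≡⟨ %-distribˡ-+ i _ M ⟩
    (i % M + (M ∸ i) % M % M) % M  ≡⟨ cong (λ t → (i % M + t) % M) (m%n%n≡m%n (M ∸ i) M) ⟩
    (i % M + (M ∸ i) % M) % M    ≡⟨ %-distribˡ-+ i _ M ⟨
    (i + (M ∸ i)) % M            ≡⟨ cong (_% M) (ℕₚ.m+[n∸m]≡n (Finₚ.toℕ≤n a)) ⟩
    M % M                        ≡⟨ n%n≡0 M ⟩
    0                            ∎)
    where
    M = suc m
    i = toℕ a
    open ≡-Reasoning

  Torsion⊆± : ℕ → Fin (suc m) → Set
  Torsion⊆± p c = ∀ a → p ⊛ a ≡ zero → a ≡ zero ⊎ a ≡ c ⊎ a ≡ ⊖ c

  torsion⊆±? : ∀ p c → Dec (Torsion⊆± p c)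
  torsion⊆±? p c =
    Finₚ.all? λ a → p ⊛ a ≟ᶠ zero →-dec (a ≟ᶠ zero ⊎-dec a ≟ᶠ c ⊎-dec a ≟ᶠ ⊖ c)

module _ {n : ℕ} (G : FinGroup n) where
  open FinGroup G
  open IsGroup isGroup using (assoc; identityˡ; identityʳ; inverseʳ)

  asGroup : Group 0ℓ 0ℓ
  asGroup = record
    { Carrier = Fin n ; _≈_ = _≡_ ; _∙_ = _·_ ; ε = e ; _⁻¹ = inv ; isGroup = isGroup }

  open import Algebra.Properties.Group asGroup
    using ( ∙-cancelˡ; identityʳ-unique; inverseˡ-unique; inverseʳ-unique; ⁻¹-involutive
          ; x≈z//y; \\-leftDividesˡ; //-rightDividesʳ)
  open import Algebra.Properties.Monoid.Mult (Group.monoid asGroup)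
    using (×-homo-+; ×-assocˡ) renaming (_×_ to _×ᴹ_)

  infixr 8 _^_
  _^_ : Fin n → ℕ → Fin n
  x ^ k = k ×ᴹ x

  ^-+ : ∀ x i j → x ^ (i + j) ≡ x ^ i · x ^ j
  ^-+ = ×-homo-+

  ^-* : ∀ x i j → (x ^ j) ^ i ≡ x ^ (i * j)
  ^-* = ×-assocˡ

  ε^ : ∀ k → e ^ k ≡ e
  ε^ zero    = refl
  ε^ (suc k) = trans (cong (e ·_) (ε^ k)) (identityˡ e)

  ^-multiple : ∀ {x p} → x ^ p ≡ e → ∀ q → x ^ (q * p) ≡ e
  ^-multiple {x} {p} x^p≡e q = trans (sym (^-* x q p)) (trans (cong (_^ q) x^p≡e) (ε^ q))

  record Subgroup (k : ℕ) : Set where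
    field
      elem           : Fin k → Fin n
      elem-injective : Injective _≡_ _≡_ elem
      ε-closed       : ∃[ c ] elem c ≡ e
      ∙-closed       : ∀ a b → ∃[ c ] elem c ≡ elem a · elem b
      ⁻¹-closed      : ∀ a → ∃[ c ] elem c ≡ inv (elem a)

  infix 4 _∈ₛ_ _∉ₛ_
  _∈ₛ_ _∉ₛ_ : ∀ {k} → Fin n → Subgroup k → Set
  x ∈ₛ H = ∃[ c ] Subgroup.elem H c ≡ x
  x ∉ₛ H = ¬ x ∈ₛ H

  module _ {k : ℕ} (H : Subgroup k) where
    open Subgroup H

    ∙-∈ : ∀ {x y} → x ∈ₛ H → y ∈ₛ H → x · y ∈ₛ H
    ∙-∈ (a , refl) (b , refl) = ∙-closed a b

    ⁻¹-∈ : ∀ {x} → x ∈ₛ H → inv x ∈ₛ H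
    ⁻¹-∈ (a , refl) = ⁻¹-closed a

    ^-∈ : ∀ {x} → x ∈ₛ H → ∀ j → x ^ j ∈ₛ H
    ^-∈ x∈H zero    = ε-closed
    ^-∈ x∈H (suc j) = ∙-∈ x∈H (^-∈ x∈H j)

  module Cosets {m : ℕ} (H : Subgroup (suc m)) where
    open Subgroup H
    open ≡-Reasoning

    rep : Fin n → Fin n
    rep y = least (λ a → y · elem a)

    rep-∈-coset : ∀ y → ∃[ a ] rep y ≡ y · elem a
    rep-∈-coset y = least-attained (λ a → y · elem a)

    rep-· : ∀ y a → rep (y · elem a) ≡ rep y
    rep-· y a = least-cong _ _ ⊆-coset coset-⊆
      where
      ⊆-coset : ∀ b → ∃[ c ] y · elem a · elem b ≡ y · elem c
      ⊆-coset b = let c , eq = ∙-closed a b in c , trans (assoc y _ _) (cong (y ·_) (sym eq))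
      coset-⊆ : ∀ b → ∃[ c ] y · elem b ≡ y · elem a · elem c
      coset-⊆ b = let a′ , eq = ⁻¹-closed a ; c , eq′ = ∙-closed a′ b in c , (begin
        y · elem b                              ≡⟨ cong (y ·_) (\\-leftDividesˡ (elem a) (elem b)) ⟨
        y · (elem a · (inv (elem a) · elem b))  ≡⟨ assoc y _ _ ⟨
        y · elem a · (inv (elem a) · elem b)    ≡⟨ cong (λ t → y · elem a · (t · elem b)) eq ⟨
        y · elem a · (elem a′ · elem b)         ≡⟨ cong (y · elem a ·_) eq′ ⟨
        y · elem a · elem c                     ∎)

    IsRep : Fin n → Set
    IsRep x = rep x ≡ x

    isRep? : ∀ x → Dec (IsRep x)
    isRep? x = rep x ≟ᶠ x

    rep-isRep : ∀ y → IsRep (rep y)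
    rep-isRep y = let a , eq = rep-∈-coset y in trans (cong rep eq) (rep-· y a)

    rep-reaches : ∀ y → ∃[ a ] rep y · elem a ≡ y
    rep-reaches y = let b , eq = rep-∈-coset y ; a , eq′ = ⁻¹-closed b in
      a , trans (cong₂ _·_ eq eq′) (//-rightDividesʳ (elem b) y)

    hits : Fin n → Fin (suc m) → Fin n → ℕ
    hits x a y = 𝟙[ isRep? x ] * 𝟙[ x · elem a ≟ᶠ y ]

    hits-from : ∀ x a → ∑[ y < n ] hits x a y ≡ 𝟙[ isRep? x ]
    hits-from x a = begin
      ∑[ y < n ] hits x a y                            ≡⟨ *-distribˡ-sum {n} 𝟙[ isRep? x ] _ ⟨
      𝟙[ isRep? x ] * ∑[ y < n ] 𝟙[ x · elem a ≟ᶠ y ]  ≡⟨ cong (𝟙[ isRep? x ] *_) (∑-𝟙≡ (x · elem a)) ⟩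
      𝟙[ isRep? x ] * 1                                ≡⟨ ℕₚ.*-identityʳ _ ⟩
      𝟙[ isRep? x ]                                    ∎

    hits-off-rep : ∀ {x y} → x ≢ rep y → ∀ a → hits x a y ≡ 0
    hits-off-rep {x} {y} x≢ry a with isRep? x | x · elem a ≟ᶠ y
    ... | no _     | _      = refl
    ... | yes _    | no _   = refl
    ... | yes rx≡x | yes eq =
      ⊥-elim (x≢ry (trans (sym rx≡x) (trans (sym (rep-· x a)) (cong rep eq))))

    hits-off-offset : ∀ {y a a₀} → rep y · elem a₀ ≡ y → a ≢ a₀ → hits (rep y) a y ≡ 0
    hits-off-offset {y} {a} {a₀} hit a≢a₀ =
      trans (cong (𝟙[ isRep? (rep y) ] *_) (𝟙-no (rep y · elem a ≟ᶠ y) (a≢a₀ ∘ cancel)))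
            (ℕₚ.*-zeroʳ 𝟙[ isRep? (rep y) ])
      where
      cancel : rep y · elem a ≡ y → a ≡ a₀
      cancel eq = elem-injective (∙-cancelˡ (rep y) _ _ (trans eq (sym hit)))

    hits-to : ∀ y → ∑[ x < n ] ∑[ a < suc m ] hits x a y ≡ 1
    hits-to y = begin
      ∑[ x < n ] ∑[ a < suc m ] hits x a y  ≡⟨ ∑-single _ (rep y) (λ _ → ∑-zero _ ∘ hits-off-rep) ⟩
      ∑[ a < suc m ] hits (rep y) a y       ≡⟨ ∑-single _ a₀ (λ _ → hits-off-offset hit) ⟩
      hits (rep y) a₀ y                     ≡⟨ cong₂ _*_ (𝟙-yes (isRep? (rep y)) (rep-isRep y))
                                                         (𝟙-yes (_ ≟ᶠ y) hit) ⟩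
      1                                     ∎
      where
      a₀ = proj₁ (rep-reaches y)
      hit = proj₂ (rep-reaches y)

    index : ℕ
    index = ∑[ x < n ] 𝟙[ isRep? x ]

    -- Double counting: each y is x · elem a for exactly one representative x and one a.
    index-formula : n ≡ index * suc m
    index-formula = begin
      n                                                ≡⟨ ℕₚ.*-identityʳ n ⟨
      n * 1                                            ≡⟨ ∑-const n 1 ⟨
      ∑[ y < n ] 1                                     ≡⟨ sum-cong-≗ hits-to ⟨
      ∑[ y < n ] ∑[ x < n ] ∑[ a < suc m ] hits x a y  ≡⟨ ∑-comm (λ x y → ∑[ a < suc m ] hits x a y) ⟨
      ∑[ x < n ] ∑[ y < n ] ∑[ a < suc m ] hits x a y  ≡⟨ sum-cong-≗ (λ x → ∑-comm (λ y a → hits x a y)) ⟩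
      ∑[ x < n ] ∑[ a < suc m ] ∑[ y < n ] hits x a y  ≡⟨ sum-cong-≗ (λ x → sum-cong-≗ (hits-from x)) ⟩
      ∑[ x < n ] ∑[ a < suc m ] 𝟙[ isRep? x ]          ≡⟨ sum-cong-≗ (λ x → ∑-const (suc m) 𝟙[ isRep? x ]) ⟩
      ∑[ x < n ] (suc m * 𝟙[ isRep? x ])               ≡⟨ *-distribˡ-sum {n} (suc m) _ ⟨
      suc m * index                                    ≡⟨ ℕₚ.*-comm (suc m) index ⟩
      index * suc m                                    ∎

  lagrange : ∀ {k} → Subgroup k → k ∣ n
  lagrange {zero}  H with () ← proj₁ (Subgroup.ε-closed H)
  lagrange {suc m} H = divides (Cosets.index H) (Cosets.index-formula H)

  -- Bézout (1 + y d ≡ x p or 1 + x p ≡ y d) writes w or w⁻¹ as (w ^ d) ^ y ∈ H, since w ^ p ≡ e.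
  prime-powers-∉ : ∀ {k} (H : Subgroup k) {p w} → Prime p → w ^ p ≡ e → w ∉ₛ H →
                   ∀ d → 0 < d → d < p → w ^ d ∉ₛ H
  prime-powers-∉ H {p} {w} p-prime w^p≡e w∉H d 0<d d<p w^d∈H
    with coprime-Bézout (prime⇒coprime p-prime {{>-nonZero 0<d}} d<p)
  ... | Bézout.+- x y eq = w∉H (subst (_∈ₛ H) (sym (inverseˡ-unique w _ (begin
    w · (w ^ d) ^ y  ≡⟨ cong (w ·_) (^-* w y d) ⟩
    w ^ (1 + y * d)  ≡⟨ cong (w ^_) eq ⟩
    w ^ (x * p)      ≡⟨ ^-multiple w^p≡e x ⟩
    e                ∎))) (⁻¹-∈ H (^-∈ H w^d∈H y)))
    where open ≡-Reasoning
  ... | Bézout.-+ x y eq = w∉H (subst (_∈ₛ H) (begin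
    (w ^ d) ^ y      ≡⟨ ^-* w y d ⟩
    w ^ (y * d)      ≡⟨ cong (w ^_) eq ⟨
    w · w ^ (x * p)  ≡⟨ cong (w ·_) (^-multiple w^p≡e x) ⟩
    w · e            ≡⟨ identityʳ w ⟩
    w                ∎) (^-∈ H w^d∈H y))
    where open ≡-Reasoning

  module _ (comm : IsAbelian G) where
    asAbelianGroup : AbelianGroup 0ℓ 0ℓ
    asAbelianGroup = record { isAbelianGroup = record { isGroup = isGroup ; comm = comm } }

    open import Algebra.Properties.AbelianGroup asAbelianGroup using (⁻¹-∙-comm)
    open import Algebra.Properties.CommutativeSemigroup
      (AbelianGroup.commutativeSemigroup asAbelianGroup) using (interchange)

    -- H⟨w⟩ = {w ^ j · h | j < p, h ∈ H}, enumerated through remQuot : Fin (p * k) → Fin p × Fin k.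
    module Adjoin {k : ℕ} (H : Subgroup k) (p : ℕ) .{{_ : NonZero p}} (w : Fin n)
                  (w^p≡e : w ^ p ≡ e) (powers-∉ : ∀ d → 0 < d → d < p → w ^ d ∉ₛ H) where
      open Subgroup H
      open ≡-Reasoning

      ^-mod : ∀ j → w ^ j ≡ w ^ toℕ (j mod p)
      ^-mod j = begin
        w ^ j                          ≡⟨ cong (w ^_) (m≡m%n+[m/n]*n j p) ⟩
        w ^ (j % p + j / p * p)        ≡⟨ ^-+ w (j % p) _ ⟩
        w ^ (j % p) · w ^ (j / p * p)  ≡⟨ cong (w ^ (j % p) ·_) (^-multiple w^p≡e (j / p)) ⟩
        w ^ (j % p) · e                ≡⟨ identityʳ _ ⟩
        w ^ (j % p)                    ≡⟨ cong (w ^_) (toℕ-fromℕ< (m%n<n j p)) ⟨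
        w ^ toℕ (j mod p)              ∎

      ^-inverse : ∀ j → j ≤ p → inv (w ^ j) ≡ w ^ (p ∸ j)
      ^-inverse j j≤p = sym (inverseʳ-unique (w ^ j) _ (begin
        w ^ j · w ^ (p ∸ j)  ≡⟨ ^-+ w j (p ∸ j) ⟨
        w ^ (j + (p ∸ j))    ≡⟨ cong (w ^_) (ℕₚ.m+[n∸m]≡n j≤p) ⟩
        w ^ p                ≡⟨ w^p≡e ⟩
        e                    ∎))

      elem′ : Fin (p * k) → Fin n
      elem′ i = let j , a = remQuot {p} k i in w ^ toℕ j · elem a

      ∈-adjoin : ∀ j {x y} → x ∈ₛ H → w ^ j · x ≡ y → ∃[ c ] elem′ c ≡ y
      ∈-adjoin j (a , refl) refl = combine (j mod p) a , (begin
        elem′ (combine (j mod p) a)  ≡⟨ cong (λ (j′ , a′) → w ^ toℕ j′ · elem a′)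
                                             (remQuot-combine (j mod p) a) ⟩
        w ^ toℕ (j mod p) · elem a   ≡⟨ cong (_· elem a) (^-mod j) ⟨
        w ^ j · elem a               ∎)

      ∙-closed′ : ∀ i i′ → ∃[ c ] elem′ c ≡ elem′ i · elem′ i′
      ∙-closed′ i i′ = let j , a = remQuot {p} k i ; j′ , a′ = remQuot {p} k i′ in
        ∈-adjoin (toℕ j + toℕ j′) (∙-closed a a′) (begin
          w ^ (toℕ j + toℕ j′) · (elem a · elem a′)      ≡⟨ cong (_· _) (^-+ w (toℕ j) (toℕ j′)) ⟩
          w ^ toℕ j · w ^ toℕ j′ · (elem a · elem a′)    ≡⟨ interchange _ _ _ _ ⟩
          (w ^ toℕ j · elem a) · (w ^ toℕ j′ · elem a′)  ∎)

      ⁻¹-closed′ : ∀ i → ∃[ c ] elem′ c ≡ inv (elem′ i)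
      ⁻¹-closed′ i = let j , a = remQuot {p} k i in
        ∈-adjoin (p ∸ toℕ j) (⁻¹-closed a) (begin
          w ^ (p ∸ toℕ j) · inv (elem a)  ≡⟨ cong (_· _) (^-inverse (toℕ j) (Finₚ.toℕ≤n j)) ⟨
          inv (w ^ toℕ j) · inv (elem a)  ≡⟨ ⁻¹-∙-comm _ _ ⟩
          inv (w ^ toℕ j · elem a)        ∎)

      no-collision : ∀ {i j} → i < j → j < p → ∀ {x y} → x ∈ₛ H → y ∈ₛ H →
                     w ^ i · x ≢ w ^ j · y
      no-collision {i} {j} i<j j<p {x} {y} x∈H y∈H eq =
        powers-∉ (j ∸ i) (ℕₚ.m<n⇒0<n∸m i<j) (ℕₚ.≤-<-trans (ℕₚ.m∸n≤m j i) j<p)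
          (subst (_∈ₛ H) (sym (x≈z//y _ y x (sym shift))) (∙-∈ H x∈H (⁻¹-∈ H y∈H)))
        where
        shift : x ≡ w ^ (j ∸ i) · y
        shift = ∙-cancelˡ (w ^ i) _ _ (begin
          w ^ i · x                  ≡⟨ eq ⟩
          w ^ j · y                  ≡⟨ cong (λ t → w ^ t · y) (ℕₚ.m+[n∸m]≡n (ℕₚ.<⇒≤ i<j)) ⟨
          w ^ (i + (j ∸ i)) · y      ≡⟨ cong (_· y) (^-+ w i (j ∸ i)) ⟩
          w ^ i · w ^ (j ∸ i) · y    ≡⟨ assoc _ _ y ⟩
          w ^ i · (w ^ (j ∸ i) · y)  ∎)

      components-injective : ∀ j a j′ a′ → w ^ toℕ j · elem a ≡ w ^ toℕ j′ · elem a′ →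
                             (j , a) ≡ (j′ , a′)
      components-injective j a j′ a′ eq with Finₚ.<-cmp j j′
      ... | tri< j<j′ _ _ = ⊥-elim (no-collision j<j′ (Finₚ.toℕ<n j′) (a , refl) (a′ , refl) eq)
      ... | tri> _ _ j′<j = ⊥-elim (no-collision j′<j (Finₚ.toℕ<n j) (a′ , refl) (a , refl) (sym eq))
      ... | tri≈ _ refl _ = cong (j ,_) (elem-injective (∙-cancelˡ (w ^ toℕ j) _ _ eq))

      elem′-injective : Injective _≡_ _≡_ elem′
      elem′-injective {i} {i′} eq = begin
        i                                   ≡⟨ combine-remQuot {p} k i ⟨
        uncurry combine (remQuot {p} k i)   ≡⟨ cong (uncurry combine) (components-injective _ _ _ _ eq) ⟩
        uncurry combine (remQuot {p} k i′)  ≡⟨ combine-remQuot {p} k i′ ⟩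
        i′                                  ∎

      adjoin : Subgroup (p * k)
      adjoin = record
        { elem           = elem′
        ; elem-injective = elem′-injective
        ; ε-closed       = ∈-adjoin 0 ε-closed (identityˡ e)
        ; ∙-closed       = ∙-closed′
        ; ⁻¹-closed      = ⁻¹-closed′
        }

    p-torsion-∈-Sylow : ∀ {k} (H : Subgroup k) {p} → Prime p → ¬ (p * k ∣ n) →
                        ∀ {w} → w ^ p ≡ e → w ∈ₛ H
    p-torsion-∈-Sylow H {p} p-prime p*k∤n {w} w^p≡e with any? (λ c → Subgroup.elem H c ≟ᶠ w)
    ... | yes w∈H = w∈H
    ... | no  w∉H = ⊥-elim (p*k∤n (lagrange (Adjoin.adjoin H p {{prime⇒nonZero p-prime}} w w^p≡e
                                                (prime-powers-∉ H p-prime w^p≡e w∉H))))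

  module CyclicSubgroup {m : ℕ} (φ : Fin (suc m) → Fin n) (φ-injective : Injective _≡_ _≡_ φ)
                        (φ-hom : ∀ a b → φ (a ⊕ b) ≡ φ a · φ b) where

    φ-zero : φ zero ≡ e
    φ-zero = identityʳ-unique (φ zero) (φ zero) (sym (φ-hom zero zero))

    φ-⊖ : ∀ a → φ (⊖ a) ≡ inv (φ a)
    φ-⊖ a = inverseʳ-unique (φ a) _
              (trans (sym (φ-hom a (⊖ a))) (trans (cong φ (⊕-inverseʳ a)) φ-zero))

    φ-⊛ : ∀ k a → φ (k ⊛ a) ≡ φ a ^ k
    φ-⊛ zero    a = φ-zero
    φ-⊛ (suc k) a = trans (φ-hom a (k ⊛ a)) (cong (φ a ·_) (φ-⊛ k a))

    image : Subgroup (suc m)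
    image = record
      { elem           = φ
      ; elem-injective = φ-injective
      ; ε-closed       = zero , φ-zero
      ; ∙-closed       = λ a b → a ⊕ b , φ-hom a b
      ; ⁻¹-closed      = λ a → ⊖ a , φ-⊖ a
      }

    p-torsion-of-cyclic-Sylow : IsAbelian G → ∀ {p} → Prime p → ¬ (p * suc m ∣ n) →
                                ∀ {c} → Torsion⊆± p c →
                                ∀ {w} → w ^ p ≡ e → w ≡ e ⊎ w ≡ φ c ⊎ w ≡ inv (φ c)
    p-torsion-of-cyclic-Sylow comm {p} p-prime p*m∤n {c} torsion⊆± w^p≡e
      with a , refl ← p-torsion-∈-Sylow comm image p-prime p*m∤n w^p≡e
      with torsion⊆± a (φ-injective (trans (φ-⊛ p a) (trans w^p≡e (sym φ-zero))))
    ... | inj₁ refl        = inj₁ φ-zero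
    ... | inj₂ (inj₁ refl) = inj₂ (inj₁ refl)
    ... | inj₂ (inj₂ refl) = inj₂ (inj₂ (φ-⊖ c))

  module _ (α : Permutation n n) (α-aut : IsAut G α) where
    aut-ε : α ⟨$⟩ʳ e ≡ e
    aut-ε = identityʳ-unique (α ⟨$⟩ʳ e) (α ⟨$⟩ʳ e)
              (trans (sym (α-aut e e)) (cong (α ⟨$⟩ʳ_) (identityˡ e)))

    aut-^ : ∀ x k → α ⟨$⟩ʳ (x ^ k) ≡ (α ⟨$⟩ʳ x) ^ k
    aut-^ x zero    = aut-ε
    aut-^ x (suc k) = trans (α-aut x (x ^ k)) (cong ((α ⟨$⟩ʳ x) ·_) (aut-^ x k))

  Rigid : Fin n → Set
  Rigid z = ∀ α → IsAut G α → α ⟨$⟩ʳ z ≡ z ⊎ α ⟨$⟩ʳ z ≡ inv z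

  rigid-of-p-torsion⊆± : ∀ {p z} → z ≢ e → (∀ {w} → w ^ p ≡ e → w ≡ e ⊎ w ≡ z ⊎ w ≡ inv z) →
                         z ^ p ≡ e → Rigid z
  rigid-of-p-torsion⊆± {p} {z} z≢e torsion⊆± z^p≡e α α-aut
    with torsion⊆± (trans (sym (aut-^ α α-aut z p)) (trans (cong (α ⟨$⟩ʳ_) z^p≡e) (aut-ε α α-aut)))
  ... | inj₁ αz≡e  = ⊥-elim (z≢e (Injection.injective (↔⇒↣ α) (trans αz≡e (sym (aut-ε α α-aut)))))
  ... | inj₂ αz≡±z = αz≡±z

  rigid-∈ : ∀ {S z} α → IsConnSet G S → Rigid z → IsAut G α → (α ⟨$⟩ʳ z ∈ S) ⇔ (z ∈ S)
  rigid-∈ {S} {z} α (_ , S-inv) z-rigid α-aut with z-rigid α α-aut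
  ... | inj₁ αz≡z   = mk⇔ (subst (_∈ S) αz≡z) (subst (_∈ S) (sym αz≡z))
  ... | inj₂ αz≡z⁻¹ =
    mk⇔ (λ αz∈S → subst (_∈ S) (⁻¹-involutive z) (S-inv _ (subst (_∈ S) αz≡z⁻¹ αz∈S)))
        (λ z∈S → subst (_∈ S) (sym αz≡z⁻¹) (S-inv z z∈S))

  ¬k-if-of-rigid : IsCI G → ∀ {z} → z ≢ e → Rigid z → ∀ k → k ≥ 2 → ¬ HasKIf G k
  ¬k-if-of-rigid CI {z} z≢e z-rigid (suc (suc k)) (s≤s (s≤s _))
                 (S , P , (P-conn , _ , P-disjoint , P-cover) , (i , Pi≡S) , P≅S) =
    0≢1 (P-disjoint zero (suc zero) z (z∈P zero) (z∈P (suc zero)))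
    where
    0≢1 : zero ≢ suc zero
    0≢1 ()
    S-conn : IsConnSet G S
    S-conn = subst (IsConnSet G) Pi≡S (P-conn i)
    z∈P⇔z∈S : ∀ j → (z ∈ P j) ⇔ (z ∈ S)
    z∈P⇔z∈S j = let α , α-aut , α-image = CI (P j) S (P-conn j) S-conn (P≅S j) in
      ⇔.trans (α-image z) (rigid-∈ α S-conn z-rigid α-aut)
    z∈S : z ∈ S
    z∈S = let j , z∈Pj = P-cover z z≢e in Equivalence.to (z∈P⇔z∈S j) z∈Pj
    z∈P : ∀ j → z ∈ P j
    z∈P j = Equivalence.from (z∈P⇔z∈S j) z∈S

  rigid-of-cyclic-Sylow : IsAbelian G → ∀ {m} → HasSylowIsoCyclic G m →
                          ∀ {p} → Prime p → p ∣ suc m →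
                          ∀ {c} → c ≢ zero → p ⊛ c ≡ zero → Torsion⊆± p c →
                          ∃[ z ] z ≢ e × Rigid z
  rigid-of-cyclic-Sylow comm (φ , φ-injective , φ-hom , q , a , q-prime , M≡q^a , q*M∤n)
                        {p} p-prime p∣M {c} c≢0 p⊛c≡0 torsion⊆±
    with refl ← prime-∣-prime-power a p-prime q-prime (subst (p ∣_) M≡q^a p∣M)
    = φ c , φc≢e , rigid-of-p-torsion⊆± {p} φc≢e
                     (p-torsion-of-cyclic-Sylow comm p-prime q*M∤n torsion⊆±)
                     (trans (sym (φ-⊛ p c)) (trans (cong φ p⊛c≡0) φ-zero))
    where
    open CyclicSubgroup φ φ-injective φ-hom
    φc≢e : φ c ≢ e
    φc≢e φc≡e = c≢0 (φ-injective (trans φc≡e (sym φ-zero)))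

rigid-element-of-Sylow : ∀ {n} (G : FinGroup n) → IsAbelian G →
                         HasSylowIsoCyclic G 3 ⊎ HasSylowIsoCyclic G 7 ⊎ HasSylowIsoCyclic G 8 →
                         ∃[ z ] z ≢ FinGroup.e G × Rigid G z
rigid-element-of-Sylow G abelian (inj₁ ℤ₄) =
  rigid-of-cyclic-Sylow G abelian ℤ₄ prime[2] (divides 2 refl) {2F} (λ ()) refl
    (from-yes (torsion⊆±? {3} 2 2F))
rigid-element-of-Sylow G abelian (inj₂ (inj₁ ℤ₈)) =
  rigid-of-cyclic-Sylow G abelian ℤ₈ prime[2] (divides 4 refl) {4F} (λ ()) refl
    (from-yes (torsion⊆±? {7} 2 4F))
rigid-element-of-Sylow G abelian (inj₂ (inj₂ ℤ₉)) =
  rigid-of-cyclic-Sylow G abelian ℤ₉ (from-yes (prime? 3)) (divides 3 refl) {3F} (λ ()) refl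
    (from-yes (torsion⊆±? {8} 3 3F))

theorem4p3 : (n : ℕ) (G : FinGroup n) → IsAbelian G → IsCI G →
    (HasSylowIsoCyclic G 3 ⊎ HasSylowIsoCyclic G 7 ⊎ HasSylowIsoCyclic G 8) →
    (k : ℕ) → k ≥ 2 → ¬ HasKIf G k
theorem4p3 n G abelian CI sylow =
  let z , z≢e , z-rigid = rigid-element-of-Sylow G abelian sylow in
  ¬k-if-of-rigid G CI z≢e z-rigid
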